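{- Let $G$ be a directed graph and let $(u,v)$ be a weak superbubble in $G$ with weak superbubble component $U$, in the sense below. Then the graph $G[U]\setminus(v,u)$ contains no cycle.
   Context: Directed graph $G=(V,E)$ with finite node set and arc set $E\subseteq V\times V$ (self-loops allowed). Paths are walks without repeated nodes; a cycle is a closed walk with at least one arc. $G[U]\setminus(v,u)$ is the induced subgraph on $U$ with the arc $(v,u)$ removed (if present). "Reachable from $u$ without passing through $v$" means via a $u$-$x$ path containing $v$ at most as its final node. $(u,v)$, with $u\neq v$, is a weak superbubble with weak superbubble component $U\subseteq V$ ($u,v\in U$) if: (a) every $x\in U$ is reachable from $u$ without passing through $v$; (b) every $x\in U$ reaches $v$ without passing through $u$; (c) for $x\in U$, $y\in V\setminus U$, every $y$-$x$ path contains $u$; (d) for $x\in U$, $y\in V\setminus U$, every $x$-$y$ path contains $v$; (e) for every arc $(x,y)$ with $x,y\in U$, every $y$-$x$ path contains both $u$ and $v$; (f) there is no node $v'\in U\setminus\{u,v\}$ such that $(u,v')$ satisfies (a)–(e) for some set $U'\subseteq V$. -}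

module Defs where

open import Data.Nat using (ℕ)
open import Data.Fin using (Fin)
open import Data.List using (List; []; _∷_)
open import Data.List.Membership.Propositional using (_∈_)
open import Data.List.Relation.Unary.Unique.Propositional using (Unique)
open import Data.Product using (Σ; _×_)
open import Relation.Nullary using (¬_)
open import Relation.Binary.PropositionalEquality using (_≡_)
open import Level using (0ℓ)
open import Relation.Unary using (Pred)

Graph : ℕ → Set₁
Graph n = Fin n → Fin n → Set

module _ {n : ℕ} (E : Graph n) where

  data Walk : Fin n → Fin n → List (Fin n) → Set where
    here : ∀ {x} → Walk x x (x ∷ [])
    step : ∀ {x y z vs} → E x y → Walk y z vs → Walk x z (x ∷ vs)

  IsPath : Fin n → Fin n → List (Fin n) → Set
  IsPath x y vs = Walk x y vs × Unique vs

  ReachableAvoiding : (u v x : Fin n) → Set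
  ReachableAvoiding u v x =
    Σ (List (Fin n)) λ vs → IsPath u x vs × (v ∈ vs → x ≡ v)

  ReachesAvoiding : (x v u : Fin n) → Set
  ReachesAvoiding x v u =
    Σ (List (Fin n)) λ vs → IsPath x v vs × (u ∈ vs → x ≡ u)

  AllPathsContain : (a b w : Fin n) → Set
  AllPathsContain a b w = ∀ vs → IsPath a b vs → w ∈ vs

  WeakSuperbubbleConds : (u v : Fin n) → Pred (Fin n) 0ℓ → Set
  WeakSuperbubbleConds u v U =
    ¬ (u ≡ v) × U u × U v
    × (∀ x → U x → ReachableAvoiding u v x)                               -- (a)
    × (∀ x → U x → ReachesAvoiding x v u)                                 -- (b)
    × (∀ x y → U x → ¬ U y → AllPathsContain y x u)                       -- (c)
    × (∀ x y → U x → ¬ U y → AllPathsContain x y v)                       -- (d)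
    × (∀ x y → U x → U y → E x y →
         AllPathsContain y x u × AllPathsContain y x v)                   -- (e)

  IsWeakSuperbubble : (u v : Fin n) → Pred (Fin n) 0ℓ → Set₁
  IsWeakSuperbubble u v U =
    WeakSuperbubbleConds u v U
    × (¬ (Σ (Fin n) λ v' → U v' × ¬ (v' ≡ u) × ¬ (v' ≡ v)
           × Σ (Pred (Fin n) 0ℓ) λ U' → WeakSuperbubbleConds u v' U'))   -- (f)

  InducedMinus : Pred (Fin n) 0ℓ → (v u : Fin n) → Graph n
  InducedMinus U v u a b = U a × U b × E a b × ¬ (a ≡ v × b ≡ u)

-- A cycle: a closed walk with at least one arc.
HasCycle : {n : ℕ} → Graph n → Set
HasCycle {n} E = Σ (Fin n) λ x → Σ (List (Fin n)) λ vs → Σ (Fin n) λ y →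
  Walk E x x (x ∷ y ∷ vs)

{-# OPTIONS --safe #-}
-- Applying (e) to the first arc (x,y) of a cycle of G[U] \ (v,u), the rest of the
-- cycle is a y-x walk and hence contains v; so v has an outgoing arc (v,z) in
-- G[U] \ (v,u), and z ≠ u. By (b), z reaches v by a path avoiding u, but by (e)
-- for the arc (v,z) every z-v path contains u; hence z = u, a contradiction.
-- Only (b) and (e) are needed.
module Submission where

open import Defs
open import Data.Nat using (ℕ)
open import Data.Fin using (Fin)
open import Data.Fin.Properties using (_≟_)
open import Data.List using (List; []; _∷_)
open import Data.List.Membership.Propositional using (_∈_)
import Data.List.Membership.DecPropositional as DecMembership
open import Data.List.Relation.Binary.Subset.Propositional using (_⊆_)
open import Data.List.Relation.Binary.Subset.Propositional.Properties using (⊆-refl)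
open import Data.List.Relation.Unary.Any using (here; there)
open import Data.List.Relation.Unary.All using ([])
open import Data.List.Relation.Unary.All.Properties using (¬Any⇒All¬)
open import Data.List.Relation.Unary.AllPairs using ([]; _∷_)
open import Data.Product using (Σ; ∃; _×_; _,_; proj₁; proj₂)
open import Data.Sum using (_⊎_; inj₁; inj₂)
open import Relation.Nullary using (¬_; yes; no)
open import Relation.Unary using (Pred)
open import Relation.Binary.PropositionalEquality using (_≡_; refl)
open import Level using (0ℓ)

Walk-map : ∀ {n} {E F : Graph n} → (∀ {a b} → E a b → F a b) →
           ∀ {x y vs} → Walk E x y vs → Walk F x y vs
Walk-map f here = here
Walk-map f (step e w) = step (f e) (Walk-map f w)

module _ {n : ℕ} {E : Graph n} where

  open DecMembership (_≟_ {n}) using (_∈?_)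

  PathWithin : Fin n → Fin n → List (Fin n) → Set
  PathWithin x y vs = Σ (List (Fin n)) λ ws → IsPath E x y ws × ws ⊆ vs

  PathWithin-mono : ∀ {x y vs ws} → vs ⊆ ws → PathWithin x y vs → PathWithin x y ws
  PathWithin-mono vs⊆ws (ps , p , ps⊆vs) = ps , p , λ k → vs⊆ws (ps⊆vs k)

  path-suffix : ∀ {x y z ws} → IsPath E x z ws → y ∈ ws → PathWithin y z ws
  path-suffix (here , uniq) (here refl) = _ , (here , uniq) , ⊆-refl
  path-suffix (step e w , uniq) (here refl) = _ , (step e w , uniq) , ⊆-refl
  path-suffix (step e w , _ ∷ uniq) (there m) = PathWithin-mono there (path-suffix (w , uniq) m)

  path-cons : ∀ {x y z vs} → E x y → PathWithin y z vs → PathWithin x z (x ∷ vs)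
  path-cons {x} e (ws , (w , uniq) , ws⊆) with x ∈? ws
  ... | yes x∈ws = PathWithin-mono (λ k → there (ws⊆ k)) (path-suffix (w , uniq) x∈ws)
  ... | no x∉ws = x ∷ ws , (step e w , ¬Any⇒All¬ ws x∉ws ∷ uniq) , λ where
    (here refl) → here refl
    (there k) → there (ws⊆ k)

  walk⇒path : ∀ {x y vs} → Walk E x y vs → PathWithin x y vs
  walk⇒path here = _ , (here , [] ∷ []) , ⊆-refl
  walk⇒path (step e w) = path-cons e (walk⇒path w)

  AllPathsContain⇒∈walk : ∀ {x y w vs} → AllPathsContain E x y w → Walk E x y vs → w ∈ vs
  AllPathsContain⇒∈walk all w with walk⇒path w
  ... | ws , p , ws⊆ = ws⊆ (all ws p)

  ∈walk⇒≡end⊎successor : ∀ {x y z vs} → Walk E x y vs → z ∈ vs → z ≡ y ⊎ ∃ (E z)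
  ∈walk⇒≡end⊎successor here (here refl) = inj₁ refl
  ∈walk⇒≡end⊎successor (step e w) (here refl) = inj₂ (_ , e)
  ∈walk⇒≡end⊎successor (step e w) (there m) = ∈walk⇒≡end⊎successor w m

  ∈closedWalk⇒successor : ∀ {x y z vs} → E x y → Walk E y x vs → z ∈ x ∷ vs → ∃ (E z)
  ∈closedWalk⇒successor e w (here refl) = _ , e
  ∈closedWalk⇒successor e w (there m) with ∈walk⇒≡end⊎successor w m
  ... | inj₁ refl = _ , e
  ... | inj₂ succ = succ

module _ {n : ℕ} {E : Graph n} {u v : Fin n} {U : Pred (Fin n) 0ℓ} where

  exit-has-no-successor : WeakSuperbubbleConds E u v U → ¬ ∃ (InducedMinus E U v u v)
  exit-has-no-successor (_ , _ , _ , _ , reach , _ , _ , arc) (z , Uv , Uz , e , vz≢vu)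
    with reach z Uz
  ... | ws , p , u∈ws⇒z≡u = vz≢vu (refl , u∈ws⇒z≡u (proj₁ (arc v z Uv Uz e) ws p))

  cycle-through-exit : WeakSuperbubbleConds E u v U → ∀ {x y vs} →
                       InducedMinus E U v u x y → Walk (InducedMinus E U v u) y x vs → v ∈ vs
  cycle-through-exit (_ , _ , _ , _ , _ , _ , _ , arc) (Ux , Uy , e , _) w =
    AllPathsContain⇒∈walk (proj₂ (arc _ _ Ux Uy e)) (Walk-map (λ (_ , _ , e′ , _) → e′) w)

lemma11 : (n : ℕ) (E : Graph n) (u v : Fin n) (U : Pred (Fin n) 0ℓ) →
    IsWeakSuperbubble E u v U → ¬ HasCycle (InducedMinus E U v u)
lemma11 n E u v U (conds , _) (_ , _ , _ , step e w) =
  exit-has-no-successor conds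
    (∈closedWalk⇒successor e w (there (cycle-through-exit conds e w)))
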